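{- Let $d, t \ge 0$ be integers and let $G$ be a finite simple graph on $n$ vertices with average degree $d(G) \le d$. Then $G$ has a subgraph $H$ such that either $\Delta(H) \le d+t-1$ and $n(H) \ge n - \left\lfloor \frac{n}{d+2t+1}\right\rfloor$, or $d(H) \le d-1$ and $n(H) = n - \left\lceil \frac{n}{d+2t+1}\right\rceil$.
   Context: For a graph $H$, $n(H)$ is its number of vertices, $\Delta(H)$ its maximum degree, and $d(H) = \frac{1}{n(H)}\sum_{v}\deg_H(v)$ its average degree. -}

module Defs where

open import Data.Nat using (ℕ; zero; suc; _+_; _*_)
open import Data.Nat.DivMod using (_/_)
open import Data.Bool using (Bool; true; false; _∧_; if_then_else_)
open import Data.Fin using (Fin; zero; suc)
open import Relation.Binary.PropositionalEquality using (_≡_)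

record Graph (n : ℕ) : Set where
  field
    adj    : Fin n → Fin n → Bool
    sym    : ∀ u v → adj u v ≡ adj v u
    irrefl : ∀ v → adj v v ≡ false
open Graph public

countTrue : ∀ {n} → (Fin n → Bool) → ℕ
countTrue {zero}  f = 0
countTrue {suc n} f = (if f zero then 1 else 0) + countTrue (λ i → f (suc i))

sumOver : ∀ {n} → (Fin n → Bool) → (Fin n → ℕ) → ℕ
sumOver {zero}  S f = 0
sumOver {suc n} S f =
  (if S zero then f zero else 0) + sumOver (λ i → S (suc i)) (λ i → f (suc i))

-- a vertex subset (the vertex set of an induced subgraph)
VSet : ℕ → Set
VSet n = Fin n → Bool

allV : ∀ {n} → VSet n
allV _ = true

nV : ∀ {n} → VSet n → ℕ
nV S = countTrue S

degIn : ∀ {n} → Graph n → VSet n → Fin n → ℕ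
degIn G S v = countTrue (λ u → S u ∧ adj G v u)

degSum : ∀ {n} → Graph n → VSet n → ℕ
degSum G S = sumOver S (degIn G S)

-- ⌊ n / (m+1) ⌋ and ⌈ n / (m+1) ⌉
floorDivSuc : ℕ → ℕ → ℕ
floorDivSuc n m = n / suc m

ceilDivSuc : ℕ → ℕ → ℕ
ceilDivSuc n m = (n + m) / suc m

-- Greedily delete a vertex of degree at least d + t in the current induced
-- subgraph, at most c = ⌈n/(d+2t+1)⌉ times. Each deletion lowers the degree sum
-- by at least 2(d + t). If the process gets stuck after j < c deletions, the
-- remaining graph has maximum degree below d + t and j ≤ ⌊n/(d+2t+1)⌋. If it
-- runs c times, the degree sum is at most dn − 2c(d + t), and n ≤ c(d+2t+1)
-- turns this into an average degree of at most d − 1 on the n − c survivors.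
module Submission where

open import Defs hiding (sym)
open import Data.Nat using (ℕ; zero; suc; _+_; _*_; _∸_; _≤_; _≥_; _<_; _≤?_; s≤s; s≤s⁻¹)
open import Data.Nat.Properties hiding (_≟_)
open import Algebra.Properties.CommutativeSemigroup +-commutativeSemigroup
  using () renaming (interchange to +-interchange)
open import Data.Nat.DivMod using (_/_; _%_; m/n≡1+[m∸n]/n; /-monoˡ-≤; m≡m%n+[m/n]*n; m%n<n)
open import Data.Nat.Tactic.RingSolver using (solve-∀)
open import Data.Fin using (Fin; zero; suc)
open import Data.Fin.Properties using (_≟_; any?)
open import Data.Bool using (Bool; true; false; _∧_; if_then_else_)
import Data.Bool.Properties as Bool
open import Data.Product using (Σ; ∃; _×_; _,_)
open import Data.Empty using (⊥-elim)
open import Data.Sum using (_⊎_; inj₁; inj₂)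
open import Relation.Nullary using (does; yes; no)
open import Relation.Nullary.Decidable using (_×-dec_)
open import Relation.Binary.PropositionalEquality
  using (_≡_; refl; sym; trans; cong; cong₂; subst; module ≡-Reasoning)

ind : Bool → ℕ
ind b = if b then 1 else 0

remove : ∀ {n} → VSet n → Fin n → VSet n
remove S v u = if does (u ≟ v) then false else S u

countTrue≡sumOver-1 : ∀ {n} (S : VSet n) → countTrue S ≡ sumOver S (λ _ → 1)
countTrue≡sumOver-1 {zero}  S = refl
countTrue≡sumOver-1 {suc n} S = cong (ind (S zero) +_) (countTrue≡sumOver-1 (λ i → S (suc i)))

countTrue-∧≡sumOver-ind : ∀ {n} (S P : VSet n) →
                          countTrue (λ u → S u ∧ P u) ≡ sumOver S (λ u → ind (P u))
countTrue-∧≡sumOver-ind {zero}  S P = refl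
countTrue-∧≡sumOver-ind {suc n} S P =
  cong₂ _+_ (ind-∧ (S zero) (P zero)) (countTrue-∧≡sumOver-ind (λ i → S (suc i)) (λ i → P (suc i)))
  where
  ind-∧ : ∀ a b → ind (a ∧ b) ≡ (if a then ind b else 0)
  ind-∧ true  b = refl
  ind-∧ false b = refl

sumOver-cong : ∀ {n} (S : VSet n) {f g : Fin n → ℕ} → (∀ u → f u ≡ g u) →
               sumOver S f ≡ sumOver S g
sumOver-cong {zero}  S f≗g = refl
sumOver-cong {suc n} S f≗g =
  cong₂ _+_ (cong (λ x → if S zero then x else 0) (f≗g zero))
            (sumOver-cong (λ i → S (suc i)) (λ i → f≗g (suc i)))

sumOver-+ : ∀ {n} (S : VSet n) (f g : Fin n → ℕ) →
            sumOver S (λ u → f u + g u) ≡ sumOver S f + sumOver S g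
sumOver-+ {zero}  S f g = refl
sumOver-+ {suc n} S f g =
  trans (cong₂ _+_ (if-+ (S zero)) (sumOver-+ (λ i → S (suc i)) (λ i → f (suc i)) (λ i → g (suc i))))
        (+-interchange (if S zero then f zero else 0) (if S zero then g zero else 0) _ _)
  where
  if-+ : ∀ b → (if b then f zero + g zero else 0) ≡ (if b then f zero else 0) + (if b then g zero else 0)
  if-+ true  = refl
  if-+ false = refl

sumOver-remove : ∀ {n} (S : VSet n) (f : Fin n → ℕ) {v} → S v ≡ true →
                 sumOver S f ≡ sumOver (remove S v) f + f v
sumOver-remove {suc n} S f {zero} Sv rewrite Sv = +-comm (f zero) _
sumOver-remove {suc n} S f {suc v} Sv =
  trans (cong (head +_) (sumOver-remove (λ i → S (suc i)) (λ i → f (suc i)) Sv))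
        (sym (+-assoc head _ _))
  where head = if S zero then f zero else 0

module _ {n} (G : Graph n) {S : VSet n} {v : Fin n} (Sv : S v ≡ true) where

  nV-remove : nV S ≡ suc (nV (remove S v))
  nV-remove = begin
    countTrue S                          ≡⟨ countTrue≡sumOver-1 S ⟩
    sumOver S (λ _ → 1)                  ≡⟨ sumOver-remove S _ Sv ⟩
    sumOver (remove S v) (λ _ → 1) + 1   ≡⟨ cong (_+ 1) (countTrue≡sumOver-1 (remove S v)) ⟨
    countTrue (remove S v) + 1           ≡⟨ +-comm _ 1 ⟩
    suc (countTrue (remove S v))         ∎
    where open ≡-Reasoning

  degIn-remove : ∀ u → degIn G S u ≡ degIn G (remove S v) u + ind (adj G u v)
  degIn-remove u = begin
    degIn G S u                                                ≡⟨ countTrue-∧≡sumOver-ind S _ ⟩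
    sumOver S (λ w → ind (adj G u w))                          ≡⟨ sumOver-remove S _ Sv ⟩
    sumOver (remove S v) (λ w → ind (adj G u w)) + ind (adj G u v)
      ≡⟨ cong (_+ ind (adj G u v)) (countTrue-∧≡sumOver-ind (remove S v) _) ⟨
    degIn G (remove S v) u + ind (adj G u v)                   ∎
    where open ≡-Reasoning

  degIn-remove-self : degIn G (remove S v) v ≡ degIn G S v
  degIn-remove-self = sym (begin
    degIn G S v                                   ≡⟨ degIn-remove v ⟩
    degIn G (remove S v) v + ind (adj G v v)      ≡⟨ cong (λ b → degIn G (remove S v) v + ind b) (irrefl G v) ⟩
    degIn G (remove S v) v + 0                    ≡⟨ +-identityʳ _ ⟩
    degIn G (remove S v) v                        ∎)
    where open ≡-Reasoning

  -- v's degree is lost once at v itself and once more spread over its neighbours.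
  degSum-remove : degSum G S ≡ degSum G (remove S v) + degIn G S v + degIn G S v
  degSum-remove = begin
    sumOver S (degIn G S)                                         ≡⟨ sumOver-remove S _ Sv ⟩
    sumOver S' (degIn G S) + degIn G S v                          ≡⟨ cong (_+ degIn G S v) (sumOver-cong S' degIn-remove) ⟩
    sumOver S' (λ u → degIn G S' u + ind (adj G u v)) + degIn G S v
      ≡⟨ cong (_+ degIn G S v) (sumOver-+ S' (degIn G S') _) ⟩
    degSum G S' + sumOver S' (λ u → ind (adj G u v)) + degIn G S v
      ≡⟨ cong (λ x → degSum G S' + x + degIn G S v) neighbours ⟩
    degSum G S' + degIn G S v + degIn G S v                       ∎
    where
    open ≡-Reasoning
    S' = remove S v
    neighbours : sumOver S' (λ u → ind (adj G u v)) ≡ degIn G S v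
    neighbours = begin
      sumOver S' (λ u → ind (adj G u v))   ≡⟨ sumOver-cong S' (λ u → cong ind (Defs.sym G u v)) ⟩
      sumOver S' (λ u → ind (adj G v u))   ≡⟨ countTrue-∧≡sumOver-ind S' _ ⟨
      degIn G S' v                         ≡⟨ degIn-remove-self ⟩
      degIn G S v                          ∎

  degSum-remove-high : ∀ {k} → k ≤ degIn G S v → degSum G (remove S v) + (k + k) ≤ degSum G S
  degSum-remove-high {k} k≤deg = begin
    degSum G (remove S v) + (k + k)                        ≡⟨ +-assoc _ k k ⟨
    degSum G (remove S v) + k + k                          ≤⟨ +-mono-≤ (+-monoʳ-≤ _ k≤deg) k≤deg ⟩
    degSum G (remove S v) + degIn G S v + degIn G S v      ≡⟨ degSum-remove ⟨
    degSum G S                                             ∎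
    where open ≤-Reasoning

highDegreeVertex? : ∀ {n} (G : Graph n) (k : ℕ) (S : VSet n) →
                    (∃ λ v → S v ≡ true × k ≤ degIn G S v)
                    ⊎ (∀ v → S v ≡ true → degIn G S v + 1 ≤ k)
highDegreeVertex? G k S with any? (λ v → (S v Bool.≟ true) ×-dec (k ≤? degIn G S v))
... | yes high = inj₁ high
... | no ¬high = inj₂ low
  where
  low : ∀ v → S v ≡ true → degIn G S v + 1 ≤ k
  low v Sv with k ≤? degIn G S v
  ... | yes k≤deg = ⊥-elim (¬high (v , Sv , k≤deg))
  ... | no k≰deg = subst (_≤ k) (+-comm 1 _) (≰⇒> k≰deg)

nV-allV : ∀ n → nV {n} allV ≡ n
nV-allV zero    = refl
nV-allV (suc n) = cong suc (nV-allV n)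

m+n≡o⇒m≡o∸n : ∀ {m n o} → m + n ≡ o → m ≡ o ∸ n
m+n≡o⇒m≡o∸n {m} {n} refl = sym (m+n∸n≡m m n)

n≤ceilDivSuc*suc : ∀ n m → n ≤ ceilDivSuc n m * suc m
n≤ceilDivSuc*suc n m = +-cancelʳ-≤ m n _ (begin
  n + m                                          ≡⟨ m≡m%n+[m/n]*n (n + m) (suc m) ⟩
  (n + m) % suc m + ceilDivSuc n m * suc m       ≤⟨ +-monoˡ-≤ _ (s≤s⁻¹ (m%n<n (n + m) (suc m))) ⟩
  m + ceilDivSuc n m * suc m                     ≡⟨ +-comm m _ ⟩
  ceilDivSuc n m * suc m + m                     ∎)
  where open ≤-Reasoning

ceilDivSuc≤1+floorDivSuc : ∀ n m → ceilDivSuc n m ≤ suc (floorDivSuc n m)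
ceilDivSuc≤1+floorDivSuc n m = begin
  (n + m) / suc m                      ≤⟨ /-monoˡ-≤ (suc m) (+-monoʳ-≤ n (n≤1+n m)) ⟩
  (n + suc m) / suc m                  ≡⟨ m/n≡1+[m∸n]/n (m≤n+m (suc m) n) ⟩
  suc ((n + suc m ∸ suc m) / suc m)    ≡⟨ cong (λ x → suc (x / suc m)) (m+n∸n≡m n (suc m)) ⟩
  suc (n / suc m)                      ∎
  where open ≤-Reasoning

<ceilDivSuc⇒≤floorDivSuc : ∀ {j} n m → j < ceilDivSuc n m → j ≤ floorDivSuc n m
<ceilDivSuc⇒≤floorDivSuc n m j<c = s≤s⁻¹ (<-≤-trans j<c (ceilDivSuc≤1+floorDivSuc n m))

sparse-after-deletions : ∀ {D s c n} d t → s + c ≡ n → n ≤ c * suc (d + t + t) →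
                         D + c * ((d + t) + (d + t)) ≤ d * n → D + s ≤ d * s
sparse-after-deletions {D} {s} {c} {n} d t s+c≡n n≤c[e+1] D≤ = +-cancelʳ-≤ (d * c) (D + s) (d * s) (begin
  D + s + d * c                        ≤⟨ +-monoˡ-≤ (d * c) (+-monoʳ-≤ D s≤ce) ⟩
  D + c * (d + t + t) + d * c          ≡⟨ regroup D c d t ⟩
  D + c * ((d + t) + (d + t))          ≤⟨ D≤ ⟩
  d * n                                ≡⟨ cong (d *_) s+c≡n ⟨
  d * (s + c)                          ≡⟨ *-distribˡ-+ d s c ⟩
  d * s + d * c                        ∎)
  where
  open ≤-Reasoning
  regroup : ∀ D c d t → D + c * (d + t + t) + d * c ≡ D + c * ((d + t) + (d + t))
  regroup = solve-∀
  s≤ce : s ≤ c * (d + t + t)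
  s≤ce = +-cancelʳ-≤ c s _ (begin
    s + c                   ≡⟨ s+c≡n ⟩
    n                       ≤⟨ n≤c[e+1] ⟩
    c * suc (d + t + t)     ≡⟨ *-suc c _ ⟩
    c + c * (d + t + t)     ≡⟨ +-comm c _ ⟩
    c * (d + t + t) + c     ∎)

module Peeling (d t : ℕ) {n} (G : Graph n) where

  Outcome : VSet n → Set
  Outcome S =
    ((∀ (v : Fin n) → S v ≡ true → degIn G S v + 1 ≤ d + t)
      × nV S ≥ n ∸ floorDivSuc n (d + t + t))
    ⊎
    (degSum G S + nV S ≤ d * nV S
      × nV S ≡ n ∸ ceilDivSuc n (d + t + t))

  -- r more deletions are allowed; j vertices have been deleted so far.
  peel : ∀ r j (S : VSet n) → r + j ≡ ceilDivSuc n (d + t + t) → nV S + j ≡ n →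
         degSum G S + j * ((d + t) + (d + t)) ≤ d * n → Σ (VSet n) Outcome
  peel zero _ S refl size budget =
    S , inj₂ (sparse-after-deletions d t size (n≤ceilDivSuc*suc n (d + t + t)) budget , m+n≡o⇒m≡o∸n size)
  peel (suc r) j S r+j≡c size budget with highDegreeVertex? G (d + t) S
  ... | inj₁ (v , Sv , high) = peel r (suc j) (remove S v) (trans (+-suc r j) r+j≡c) size′ budget′
    where
    size′ : nV (remove S v) + suc j ≡ n
    size′ = trans (+-suc _ j) (trans (cong (_+ j) (sym (nV-remove G Sv))) size)
    budget′ : degSum G (remove S v) + suc j * ((d + t) + (d + t)) ≤ d * n
    budget′ = begin
      degSum G (remove S v) + ((d + t) + (d + t) + j * ((d + t) + (d + t)))
        ≡⟨ +-assoc (degSum G (remove S v)) _ _ ⟨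
      degSum G (remove S v) + ((d + t) + (d + t)) + j * ((d + t) + (d + t))
        ≤⟨ +-monoˡ-≤ _ (degSum-remove-high G Sv high) ⟩
      degSum G S + j * ((d + t) + (d + t))
        ≤⟨ budget ⟩
      d * n ∎
      where open ≤-Reasoning
  ... | inj₂ low = S , inj₁ (low , large)
    where
    open ≤-Reasoning
    j<c : j < ceilDivSuc n (d + t + t)
    j<c = subst (j <_) r+j≡c (s≤s (m≤n+m j r))
    large : nV S ≥ n ∸ floorDivSuc n (d + t + t)
    large = begin
      n ∸ floorDivSuc n (d + t + t)   ≤⟨ ∸-monoʳ-≤ n (<ceilDivSuc⇒≤floorDivSuc n (d + t + t) j<c) ⟩
      n ∸ j                           ≡⟨ m+n≡o⇒m≡o∸n size ⟨
      nV S                            ∎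

lemma14 : (d t n : ℕ) (G : Graph n) →
          degSum G allV ≤ d * n →
          Σ (VSet n) (λ S →
            ((∀ (v : Fin n) → S v ≡ true → degIn G S v + 1 ≤ d + t)
              × nV S ≥ n ∸ floorDivSuc n (d + t + t))
            ⊎
            (degSum G S + nV S ≤ d * nV S
              × nV S ≡ n ∸ ceilDivSuc n (d + t + t)))
lemma14 d t n G degSum≤ =
  Peeling.peel d t G (ceilDivSuc n (d + t + t)) 0 allV
    (+-identityʳ _) (trans (+-identityʳ _) (nV-allV n)) (subst (_≤ d * n) (sym (+-identityʳ _)) degSum≤)
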